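{- For all integers $n,r\geq 2$, the path $P_n$ is $(2r,r)$-star colorable.
   Context: $P_n$ denotes the path on $n$ vertices. A star edge coloring of a graph is a proper edge coloring such that no path or cycle with four edges uses at most two colors. For an edge coloring $f$ and a vertex $v$, $A_f(v)$ denotes the set of colors of edges incident to $v$. Two star edge colorings $f_1,f_2$ of $G$ are star compatible if $A_{f_1}(v)\cap A_{f_2}(v)=\emptyset$ for every vertex $v$. $G$ is $(k,t)$-star colorable if $G$ has $t$ pairwise star compatible star edge colorings $f_i:E(G)\to\{0,1,\ldots,k-1\}$, $1\le i\le t$. -}

module Defs where

open import Data.Nat using (ℕ; suc)
open import Data.Fin using (Fin; toℕ)
open import Data.Product using (_×_; Σ; ∃₂)
open import Data.Sum using (_⊎_)
open import Relation.Binary.PropositionalEquality using (_≡_; _≢_)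
open import Relation.Nullary using (¬_)

record Graph (n : ℕ) : Set₁ where
  field
    Adj   : Fin n → Fin n → Set
    sym   : ∀ {u v} → Adj u v → Adj v u
    irrefl : ∀ {u} → ¬ Adj u u
open Graph public

PathAdj : (n : ℕ) → Fin n → Fin n → Set
PathAdj n i j = (toℕ j ≡ suc (toℕ i)) ⊎ (toℕ i ≡ suc (toℕ j))

P : (n : ℕ) → Graph n
P n = record { Adj = PathAdj n ; sym = sym′ ; irrefl = irr }
  where
  open import Data.Sum using (inj₁; inj₂)
  open import Data.Nat.Properties using (<-irrefl; n<1+n)
  open import Relation.Binary.PropositionalEquality using (sym)
  sym′ : ∀ {u v} → PathAdj n u v → PathAdj n v u
  sym′ (inj₁ e) = inj₂ e
  sym′ (inj₂ e) = inj₁ e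
  irr : ∀ {u} → ¬ PathAdj n u u
  irr {u} (inj₁ e) = <-irrefl e (n<1+n (toℕ u))
  irr {u} (inj₂ e) = <-irrefl e (n<1+n (toℕ u))

-- An edge colouring with colours {0,…,k-1}: the colour of edge uv is f u v;
-- it must be symmetric on edges (values on non-edges are irrelevant).
record EdgeColoring {n : ℕ} (G : Graph n) (k : ℕ) : Set where
  field
    col     : Fin n → Fin n → Fin k
    col-sym : ∀ u v → Adj G u v → col u v ≡ col v u
open EdgeColoring public

Proper : ∀ {n k} (G : Graph n) → EdgeColoring G k → Set
Proper G f = ∀ u v w → Adj G u v → Adj G u w → v ≢ w → col f u v ≢ col f u w

-- A path or cycle with four edges: vertices v0 v1 v2 v3 v4, consecutive ones adjacent,
-- all pairwise distinct except that v0 = v4 is allowed (the cycle case).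
record FourEdgePathOrCycle {n : ℕ} (G : Graph n) : Set where
  field
    v0 v1 v2 v3 v4 : Fin n
    a01 : Adj G v0 v1
    a12 : Adj G v1 v2
    a23 : Adj G v2 v3
    a34 : Adj G v3 v4
    d01 : v0 ≢ v1
    d02 : v0 ≢ v2
    d03 : v0 ≢ v3
    d12 : v1 ≢ v2
    d13 : v1 ≢ v3
    d14 : v1 ≢ v4
    d23 : v2 ≢ v3
    d24 : v2 ≢ v4
    d34 : v3 ≢ v4
open FourEdgePathOrCycle public

UsesAtMostTwoColors : ∀ {n k} {G : Graph n} → EdgeColoring G k → FourEdgePathOrCycle G → Set
UsesAtMostTwoColors f p =
  ∃₂ λ a b → In (col f (v0 p) (v1 p)) a b × In (col f (v1 p) (v2 p)) a b
           × In (col f (v2 p) (v3 p)) a b × In (col f (v3 p) (v4 p)) a b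
  where
  In : ∀ {k} → Fin k → Fin k → Fin k → Set
  In c a b = (c ≡ a) ⊎ (c ≡ b)

StarEdgeColoring : ∀ {n k} (G : Graph n) → EdgeColoring G k → Set
StarEdgeColoring G f = Proper G f × (∀ (p : FourEdgePathOrCycle G) → ¬ UsesAtMostTwoColors f p)

-- A_f(v) ∩ A_g(v) = ∅ for every vertex v, unfolded: no colour of an edge at v under f
-- equals a colour of an edge at v under g.
StarCompatible : ∀ {n k} (G : Graph n) → EdgeColoring G k → EdgeColoring G k → Set
StarCompatible G f g = ∀ v u w → Adj G v u → Adj G v w → col f v u ≢ col g v w

StarColorable : ∀ {n} (G : Graph n) (k t : ℕ) → Set
StarColorable G k t =
  Σ (Fin t → EdgeColoring G k) λ f →
    (∀ i → StarEdgeColoring G (f i)) × (∀ i j → i ≢ j → StarCompatible G (f i) (f j))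

module Submission where

-- Index the edge {a, a+1} of the path P_n by its lower endpoint a
-- (that is, by toℕ u ⊓ toℕ v).  With m = 2r colours, the i-th colouring
-- (0 ≤ i < r) gives edge a the colour (2i + a) mod m: it runs cyclically
-- through all colours, starting from the even offset 2i.
--
--  * Modular arithmetic: x and d + x are distinct modulo m when 0 < d < m.
--    Hence three consecutive edges get three distinct colours (m ≥ 3); two
--    colourings i ≠ j never agree on the same edge (their offsets differ by
--    2(j - i), and 0 < 2(j - i) < m), nor on adjacent edges (the colours then
--    differ in parity, and m is even).
--  * Geometry of the path: distinct edges at a vertex have consecutive indices,
--    and a walk of three edges that does not turn back has edge indices
--    t, t+1, t+2 in increasing or decreasing order.
--  * Hence a colouring by edge index that is injective on any three consecutive
--    indices is a star edge colouring (a path with four edges already sees three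
--    colours on its first three edges), and two such colourings are star
--    compatible once they disagree on equal and on adjacent indices.

open import Defs hiding (sym)
open import Data.Nat using (ℕ; _≤_; _*_)
open import Data.Nat.Base using (suc; _+_; _<_; _/_; _%_; _⊓_; NonZero; >-nonZero; s≤s; z≤n)
open import Data.Nat.Properties
  using (+-assoc; +-comm; +-cancelˡ-≡; ⊓-comm; m≤n⇒m⊓n≡m; m≥n⇒m⊓n≡n; n≤1+n;
         <-cmp; <-trans; ≤-<-trans; m≤n+m; *-monoʳ-<; m≤n⇒∃[o]m+o≡n; ≤⇒≯)
open import Data.Nat.DivMod using (_mod_; m≡m%n+[m/n]*n; m∣n⇒o%n%m≡o%m; %-remove-+ˡ)
open import Data.Nat.Divisibility using (_∣_; ∣m+n∣m⇒∣n; n∣m*n; m∣m*n; ∣⇒≤)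
open import Data.Nat.Solver using (module +-*-Solver)
open import Data.Fin using (Fin; toℕ)
open import Data.Fin.Properties using (toℕ-injective; toℕ-fromℕ<; toℕ<n)
open import Data.Empty using (⊥; ⊥-elim)
open import Data.Product using (_×_; _,_; proj₁)
open import Data.Sum using (_⊎_; inj₁; inj₂)
open import Function using (_∘_)
open import Relation.Nullary using (¬_)
open import Relation.Binary using (tri<; tri≈; tri>)
open import Relation.Binary.PropositionalEquality
  using (_≡_; _≢_; refl; sym; trans; cong; subst; module ≡-Reasoning)

ThreeDistinct : {A : Set} → A → A → A → Set
ThreeDistinct x y z = x ≢ y × y ≢ z × x ≢ z

reverse-distinct : {A : Set} {x y z : A} → ThreeDistinct x y z → ThreeDistinct z y x
reverse-distinct (x≢y , y≢z , x≢z) = y≢z ∘ sym , x≢y ∘ sym , x≢z ∘ sym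

distinct-not-in-pair : {A : Set} {x y z a b : A} → ThreeDistinct x y z →
  (x ≡ a ⊎ x ≡ b) → (y ≡ a ⊎ y ≡ b) → (z ≡ a ⊎ z ≡ b) → ⊥
distinct-not-in-pair (x≢y , _ , _) (inj₁ refl) (inj₁ refl) _ = x≢y refl
distinct-not-in-pair (x≢y , _ , _) (inj₂ refl) (inj₂ refl) _ = x≢y refl
distinct-not-in-pair (_ , _ , x≢z) (inj₁ refl) (inj₂ refl) (inj₁ refl) = x≢z refl
distinct-not-in-pair (_ , y≢z , _) (inj₁ refl) (inj₂ refl) (inj₂ refl) = y≢z refl
distinct-not-in-pair (_ , y≢z , _) (inj₂ refl) (inj₁ refl) (inj₁ refl) = y≢z refl
distinct-not-in-pair (_ , _ , x≢z) (inj₂ refl) (inj₁ refl) (inj₂ refl) = x≢z refl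

congruent⇒∣ : ∀ m .{{_ : NonZero m}} x d → x % m ≡ (d + x) % m → m ∣ d
congruent⇒∣ m x d eq = ∣m+n∣m⇒∣n m∣q*m+d (n∣m*n (x / m))
  where
  open ≡-Reasoning
  q*m+d≡q′*m : x / m * m + d ≡ (d + x) / m * m
  q*m+d≡q′*m = +-cancelˡ-≡ (x % m) _ _ (begin
    x % m + (x / m * m + d)    ≡⟨ sym (+-assoc (x % m) _ d) ⟩
    x % m + x / m * m + d      ≡⟨ cong (_+ d) (sym (m≡m%n+[m/n]*n x m)) ⟩
    x + d                      ≡⟨ +-comm x d ⟩
    d + x                      ≡⟨ m≡m%n+[m/n]*n (d + x) m ⟩
    (d + x) % m + (d + x) / m * m  ≡⟨ cong (_+ (d + x) / m * m) (sym eq) ⟩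
    x % m + (d + x) / m * m    ∎)
  m∣q*m+d : m ∣ x / m * m + d
  m∣q*m+d = subst (m ∣_) (sym q*m+d≡q′*m) (n∣m*n ((d + x) / m))

shift-changes-residue : ∀ m .{{_ : NonZero m}} x d → suc d < m → x % m ≢ (suc d + x) % m
shift-changes-residue m x d d<m eq = ≤⇒≯ (∣⇒≤ (congruent⇒∣ m x (suc d) eq)) d<m

InjectiveOnTriples : ∀ {k} → (ℕ → Fin k) → Set
InjectiveOnTriples g = ∀ t → ThreeDistinct (g t) (g (suc t)) (g (suc (suc t)))

rotation : ∀ m .{{_ : NonZero m}} → ℕ → ℕ → Fin m
rotation m c t = (c + t) mod m

mod-≢ : ∀ {m} .{{_ : NonZero m}} {x y} → x % m ≢ y % m → x mod m ≢ y mod m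
mod-≢ ne eq = ne (trans (sym (toℕ-fromℕ< _)) (trans (cong toℕ eq) (toℕ-fromℕ< _)))

rotation-injectiveOnTriples : ∀ m .{{_ : NonZero m}} → 2 < m → ∀ c → InjectiveOnTriples (rotation m c)
rotation-injectiveOnTriples m 2<m c t =
  mod-≢ (shifted 0 1<m t) , mod-≢ (shifted 0 1<m (suc t)) , mod-≢ (shifted 1 2<m t)
  where
  1<m : 1 < m
  1<m = <-trans (s≤s (s≤s z≤n)) 2<m
  shifted : ∀ d → suc d < m → ∀ t → (c + t) % m ≢ (c + (suc d + t)) % m
  shifted d d<m t eq = shift-changes-residue m (c + t) d d<m (trans eq (cong (_% m) reorder))
    where
    reorder : c + (suc d + t) ≡ suc d + (c + t)
    reorder = trans (sym (+-assoc c (suc d) t))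
                (trans (cong (_+ t) (+-comm c (suc d))) (+-assoc (suc d) c t))

Step : ℕ → ℕ → Set
Step a b = b ≡ suc a ⊎ a ≡ suc b

-- The index of an edge {a, b} of the path is its lower endpoint a ⊓ b.
⊓-up : ∀ a → a ⊓ suc a ≡ a
⊓-up a = m≤n⇒m⊓n≡m (n≤1+n a)

⊓-down : ∀ a → suc a ⊓ a ≡ a
⊓-down a = m≥n⇒m⊓n≡n (n≤1+n a)

edges-at-vertex : ∀ {a b c} → Step a b → Step a c → b ≡ c ⊎ Step (a ⊓ b) (a ⊓ c)
edges-at-vertex (inj₁ refl) (inj₁ refl) = inj₁ refl
edges-at-vertex (inj₂ refl) (inj₂ refl) = inj₁ refl
edges-at-vertex {c = c} (inj₁ refl) (inj₂ refl) rewrite ⊓-up c | ⊓-down c = inj₂ (inj₂ refl)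
edges-at-vertex {b = b} (inj₂ refl) (inj₁ refl) rewrite ⊓-up b | ⊓-down b = inj₂ (inj₁ refl)

data Consecutive : ℕ → ℕ → ℕ → Set where
  ascending  : ∀ t → Consecutive t (suc t) (suc (suc t))
  descending : ∀ t → Consecutive (suc (suc t)) (suc t) t

-- A walk a₀ a₁ a₂ a₃ in the path that never turns back runs monotonically,
-- so its three edges have consecutive indices.
walk-indices : ∀ {a₀ a₁ a₂ a₃} → Step a₀ a₁ → Step a₁ a₂ → Step a₂ a₃ → a₀ ≢ a₂ → a₁ ≢ a₃ →
  Consecutive (a₀ ⊓ a₁) (a₁ ⊓ a₂) (a₂ ⊓ a₃)
walk-indices (inj₁ refl) (inj₂ refl) _ a₀≢a₂ _ = ⊥-elim (a₀≢a₂ refl)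
walk-indices (inj₂ refl) (inj₁ refl) _ a₀≢a₂ _ = ⊥-elim (a₀≢a₂ refl)
walk-indices _ (inj₁ refl) (inj₂ refl) _ a₁≢a₃ = ⊥-elim (a₁≢a₃ refl)
walk-indices _ (inj₂ refl) (inj₁ refl) _ a₁≢a₃ = ⊥-elim (a₁≢a₃ refl)
walk-indices {a₀} (inj₁ refl) (inj₁ refl) (inj₁ refl) _ _ rewrite ⊓-up a₀ = ascending a₀
walk-indices {a₃ = a₃} (inj₂ refl) (inj₂ refl) (inj₂ refl) _ _ rewrite ⊓-down a₃ = descending a₃

consecutive-distinct : ∀ {k} {g : ℕ → Fin k} {x y z} → InjectiveOnTriples g →
  Consecutive x y z → ThreeDistinct (g x) (g y) (g z)
consecutive-distinct injective (ascending t)  = injective t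
consecutive-distinct injective (descending t) = reverse-distinct (injective t)

step-distinct : ∀ {k} {g : ℕ → Fin k} {s t} → InjectiveOnTriples g → Step s t → g s ≢ g t
step-distinct {s = s} injective (inj₁ refl) = proj₁ (injective s)
step-distinct {t = t} injective (inj₂ refl) = proj₁ (injective t) ∘ sym

pathColoring : ∀ {n k} → (ℕ → Fin k) → EdgeColoring (P n) k
pathColoring g = record
  { col     = λ u v → g (toℕ u ⊓ toℕ v)
  ; col-sym = λ u v _ → cong g (⊓-comm (toℕ u) (toℕ v))
  }

pathColoring-star : ∀ {n k} {g : ℕ → Fin k} → InjectiveOnTriples g → StarEdgeColoring (P n) (pathColoring g)
pathColoring-star {n} {g = g} injective = proper , no-bicoloured-path
  where
  proper : Proper (P n) (pathColoring g)
  proper u v w uv uw v≢w with edges-at-vertex uv uw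
  ... | inj₁ v≡w  = ⊥-elim (v≢w (toℕ-injective v≡w))
  ... | inj₂ step = step-distinct injective step
  no-bicoloured-path : ∀ p → ¬ UsesAtMostTwoColors (pathColoring g) p
  no-bicoloured-path p (_ , _ , c₀₁ , c₁₂ , c₂₃ , _) =
    distinct-not-in-pair (consecutive-distinct injective indices) c₀₁ c₁₂ c₂₃
    where
    indices = walk-indices (a01 p) (a12 p) (a23 p) (d02 p ∘ toℕ-injective) (d13 p ∘ toℕ-injective)

pathColoring-compatible : ∀ {n k} {g h : ℕ → Fin k} → (∀ t → g t ≢ h t) →
  (∀ {s t} → Step s t → g s ≢ h t) → StarCompatible (P n) (pathColoring g) (pathColoring h)
pathColoring-compatible same adjacent v u w vu vw with edges-at-vertex vu vw
... | inj₁ u≡w rewrite u≡w = same _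
... | inj₂ step = adjacent step

module Offsets (r : ℕ) (2≤r : 2 ≤ r) where

  m : ℕ
  m = 2 * r

  2<m : 2 < m
  2<m = *-monoʳ-< 2 2≤r

  instance
    m-nonZero : NonZero m
    m-nonZero = >-nonZero (<-trans (s≤s z≤n) 2<m)

  offsetColoring : ℕ → ℕ → Fin m
  offsetColoring i = rotation m (2 * i)

  offset-injectiveOnTriples : ∀ i → InjectiveOnTriples (offsetColoring i)
  offset-injectiveOnTriples i = rotation-injectiveOnTriples m 2<m (2 * i)

  smaller-offset-differs : ∀ {i j} t → i < j → j < r → (2 * i + t) % m ≢ (2 * j + t) % m
  smaller-offset-differs {i} t i<j j<r with m≤n⇒∃[o]m+o≡n i<j
  ... | o , refl = λ eq → shift-changes-residue m (2 * i + t) _ 2[1+o]<m (trans eq (cong (_% m) regroup))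
    where
    2[1+o]<m : 2 * suc o < m
    2[1+o]<m = *-monoʳ-< 2 (≤-<-trans (s≤s (m≤n+m o i)) j<r)
    regroup : 2 * (suc i + o) + t ≡ 2 * suc o + (2 * i + t)
    regroup = solve 3 (λ i o t → con 2 :* (con 1 :+ i :+ o) :+ t := con 2 :* (con 1 :+ o) :+ (con 2 :* i :+ t))
                refl i o t
      where open +-*-Solver

  offsets-same-edge : ∀ {i j} → i < r → j < r → i ≢ j → ∀ t → offsetColoring i t ≢ offsetColoring j t
  offsets-same-edge {i} {j} i<r j<r i≢j t with <-cmp i j
  ... | tri< i<j _ _ = mod-≢ (smaller-offset-differs t i<j j<r)
  ... | tri≈ _ i≡j _ = ⊥-elim (i≢j i≡j)
  ... | tri> _ _ j<i = mod-≢ (smaller-offset-differs t j<i i<r ∘ sym)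

  parity : ∀ i t → (2 * i + t) % m % 2 ≡ t % 2
  parity i t = trans (m∣n⇒o%n%m≡o%m 2 m (2 * i + t) (m∣m*n r)) (%-remove-+ˡ t (m∣m*n i))

  -- Colours whose indices differ by one have different parity, so they differ.
  parity-differs : ∀ i j t → (2 * i + suc t) % m ≢ (2 * j + t) % m
  parity-differs i j t eq = shift-changes-residue 2 t 0 (s≤s (s≤s z≤n))
    (trans (sym (parity j t)) (trans (cong (_% 2) (sym eq)) (parity i (suc t))))

  offsets-adjacent-edges : ∀ i j {s t} → Step s t → offsetColoring i s ≢ offsetColoring j t
  offsets-adjacent-edges i j {s}     (inj₁ refl) = mod-≢ (parity-differs j i s ∘ sym)
  offsets-adjacent-edges i j {t = t} (inj₂ refl) = mod-≢ (parity-differs i j t)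

-- The main theorem: the r offset colourings with 2r colours witness that P_n is
-- (2r, r)-star colorable.
theorem4 : ∀ (n r : ℕ) → 2 ≤ n → 2 ≤ r → StarColorable (P n) (2 * r) r
theorem4 n r _ 2≤r = coloring , star , compatible
  where
  open Offsets r 2≤r
  coloring : Fin r → EdgeColoring (P n) (2 * r)
  coloring i = pathColoring (offsetColoring (toℕ i))
  star : ∀ i → StarEdgeColoring (P n) (coloring i)
  star i = pathColoring-star (offset-injectiveOnTriples (toℕ i))
  compatible : ∀ i j → i ≢ j → StarCompatible (P n) (coloring i) (coloring j)
  compatible i j i≢j = pathColoring-compatible
    (offsets-same-edge (toℕ<n i) (toℕ<n j) (i≢j ∘ toℕ-injective))
    (offsets-adjacent-edges (toℕ i) (toℕ j))
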